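{- For every $n\ge1$ and $\pi\in\mathfrak{B}_n$, \[\mathcal{D}_B(\pi)=2^{\mathrm{pe}_B(\pi)+\varsigma(\pi)}\sum_{\substack{D\subseteq\{0,\dots,n-1\}\\ \mathrm{Pe}_B(\pi)\subseteq D\,\triangle\,(D+1)\\ \pi(1)<0\ \Rightarrow\ 0\in D}}L_D.\]
   Context: $\mathfrak{B}_n$: signed permutations, bijections $\pi$ of $\{ -n,\dots,n\}$ with $\pi(-i)=-\pi(i)$, $\pi(0)=0$. $\mathrm{Des}_B(\pi)=\{i\in\{0,\dots,n-1\}:\pi(i)>\pi(i+1)\}$; $\mathrm{Pe}_B(\pi)=\{i\in\{1,\dots,n-1\}:\pi(i-1)<\pi(i)>\pi(i+1)\}$, $\mathrm{pe}_B(\pi)=|\mathrm{Pe}_B(\pi)|$; $\varsigma(\pi)=0$ if $\pi(1)>0$, $1$ if $\pi(1)<0$. $D+1=\{d+1:d\in D\}$ and $\triangle$ is symmetric difference. Let $T_\infty=\{0,1^{ -1},1,2^{ -1},2,\dots\}$ be totally ordered as listed, with $\varepsilon(0)=\varepsilon(j)=1$, $\varepsilon(j^{ -1})=-1$, $|0|=0$, $|j|=|j^{ -1}|=j$. Write $a\le^+b$ if $a<b$ or ($a=b$, $\varepsilon(a)=1$), $a\le^-b$ if $a<b$ or ($a=b$, $\varepsilon(a)=-1$). With commuting indeterminates $z_0,z_1,\dots$, $\mathcal{D}_B(\pi)=\sum\prod_{s=1}^n z_{|a_s|}$ over all $(a_1,\dots,a_n)\in T_\infty^n$ such that, with $a_0=0$,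 for each $s\in\{0,\dots,n-1\}$, $a_s\le^+a_{s+1}$ if $s\notin\mathrm{Des}_B(\pi)$ and $a_s\le^-a_{s+1}$ if $s\in\mathrm{Des}_B(\pi)$. For $S=\{s_1<\dots<s_m\}\subseteq\{0,\dots,n-1\}$ (with $s_{m+1}:=n$), $N_S=\sum_{0<i_1<\dots<i_m}z_0^{s_1}\prod_{r=1}^m z_{i_r}^{s_{r+1}-s_r}$, and the type B fundamental quasisymmetric function is $L_S=\sum_{S\subseteq T\subseteq\{0,\dots,n-1\}}N_T$. -}

module Defs where

open import Data.Nat as ℕ using (ℕ; zero; suc; _≤_; _∸_)
open import Data.Integer as ℤ using (ℤ; ∣_∣)
open import Data.Bool using (Bool; true; false; _∧_; _∨_; not; if_then_else_; _xor_)
open import Data.Fin using (Fin; fromℕ<)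
open import Data.List using (List; []; _∷_; map; concatMap; foldr; length; upTo; _++_; filterᵇ)
open import Data.Product using (_×_)
open import Relation.Binary.PropositionalEquality using (_≡_)
open import Relation.Nullary.Decidable using (⌊_⌋; yes; no)
open import Function.Definitions using (Injective)
open import Algebra.Bundles using (CommutativeSemiring)

-- Signed permutations of B_n, recorded by their values π(1),…,π(n):
-- w i = π(i+1).  A bijection of {-n..n} with π(-i) = -π(i), π(0) = 0 is
-- exactly determined by such values with |π(1)|,…,|π(n)| a permutation
-- of {1,…,n}.

record SignedPerm (n : ℕ) : Set where
  field
    w       : Fin n → ℤ
    inRange : ∀ i → 1 ≤ ∣ w i ∣ × ∣ w i ∣ ≤ n
    absInj  : Injective _≡_ _≡_ (λ i → ∣ w i ∣)

-- π(i) for i ∈ {0,…,n} (π(0) = 0; value 0 outside the range, never used)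
val : ∀ {n} → SignedPerm n → ℕ → ℤ
val π zero = ℤ.+ 0
val {n} π (suc i) with i ℕ.<? n
... | yes p = SignedPerm.w π (fromℕ< p)
... | no _  = ℤ.+ 0

isDes : ∀ {n} → SignedPerm n → ℕ → Bool
isDes π i = ⌊ val π (suc i) ℤ.<? val π i ⌋

isPeak : ∀ {n} → SignedPerm n → ℕ → Bool
isPeak π zero = false
isPeak {n} π (suc k) =
  ⌊ suc k ℕ.<? n ⌋ ∧ ⌊ val π k ℤ.<? val π (suc k) ⌋
                  ∧ ⌊ val π (suc (suc k)) ℤ.<? val π (suc k) ⌋

PeB : ∀ {n} → SignedPerm n → List ℕ
PeB {n} π = filterᵇ (isPeak π) (upTo n)

peB : ∀ {n} → SignedPerm n → ℕ
peB π = length (PeB π)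

firstNeg : ∀ {n} → SignedPerm n → Bool
firstNeg π = ⌊ val π 1 ℤ.<? ℤ.+ 0 ⌋

ς : ∀ {n} → SignedPerm n → ℕ
ς π = if firstNeg π then 1 else 0

-- The totally ordered alphabet T_∞ = {0, 1⁻¹, 1, 2⁻¹, 2, …}

data T∞ : Set where
  t0   : T∞
  tneg : ℕ → T∞   -- tneg k = (k+1)⁻¹
  tpos : ℕ → T∞   -- tpos k = k+1

rank : T∞ → ℕ
rank t0       = 0
rank (tneg k) = 1 ℕ.+ 2 ℕ.* k
rank (tpos k) = 2 ℕ.+ 2 ℕ.* k

εpos : T∞ → Bool
εpos t0       = true
εpos (tneg _) = false
εpos (tpos _) = true

absT : T∞ → ℕ
absT t0       = 0
absT (tneg k) = suc k
absT (tpos k) = suc k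

_≤⁺_ : T∞ → T∞ → Bool
a ≤⁺ b = ⌊ rank a ℕ.<? rank b ⌋ ∨ (⌊ rank a ℕ.≟ rank b ⌋ ∧ εpos a)

_≤⁻_ : T∞ → T∞ → Bool
a ≤⁻ b = ⌊ rank a ℕ.<? rank b ⌋ ∨ (⌊ rank a ℕ.≟ rank b ⌋ ∧ not (εpos a))

lettersUpTo : ℕ → List T∞
lettersUpTo K = t0 ∷ concatMap (λ k → tneg k ∷ tpos k ∷ []) (upTo K)

tuples : ∀ {a} {A : Set a} → ℕ → List A → List (List A)
tuples zero    xs = [] ∷ []
tuples (suc m) xs = concatMap (λ x → map (x ∷_) (tuples m xs)) xs

-- the condition on (a_1,…,a_n) in the definition of 𝒟_B(π):
-- validFrom π s a_s (a_{s+1} ∷ …) checks the relations for s, s+1, …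
validFrom : ∀ {n} → SignedPerm n → ℕ → T∞ → List T∞ → Bool
validFrom π s prev []       = true
validFrom π s prev (x ∷ xs) =
  (if isDes π s then prev ≤⁻ x else prev ≤⁺ x) ∧ validFrom π (suc s) x xs

-- Subsets of {0,…,n-1} as characteristic lists of length n

subsets : ℕ → List (List Bool)
subsets n = tuples n (false ∷ true ∷ [])

memB : ℕ → List Bool → Bool
memB i       []       = false
memB zero    (b ∷ _)  = b
memB (suc i) (_ ∷ bs) = memB i bs

subsetB : List Bool → List Bool → Bool
subsetB []       _        = true
subsetB (b ∷ bs) []       = not b
subsetB (b ∷ bs) (c ∷ cs) = (not b ∨ c) ∧ subsetB bs cs

elemsFrom : ℕ → List Bool → List ℕ
elemsFrom k []       = []
elemsFrom k (b ∷ bs) = if b then k ∷ elemsFrom (suc k) bs else elemsFrom (suc k) bs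

elems : List Bool → List ℕ
elems = elemsFrom 0

choose : List ℕ → ℕ → List (List ℕ)
choose xs       zero    = [] ∷ []
choose []       (suc m) = []
choose (x ∷ xs) (suc m) = map (x ∷_) (choose xs m) ++ choose xs (suc m)

condD : ∀ {n} → SignedPerm n → List Bool → Bool
condD π D = foldr (λ i r → (memB i D xor memB (i ∸ 1) D) ∧ r) true (PeB π)
            ∧ (not (firstNeg π) ∨ memB 0 D)

-- Evaluation of the (degree n) series in the variables z_0,…,z_K
-- (all other variables set to 0) in an arbitrary commutative semiring.

module Eval {c ℓ} (R : CommutativeSemiring c ℓ) where
  open CommutativeSemiring R renaming (Carrier to A)

  Σ : List A → A
  Σ = foldr _+_ 0#

  Π : List A → A
  Π = foldr _*_ 1#

  pow : A → ℕ → A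
  pow x zero    = 1#
  pow x (suc k) = x * pow x k

  DB : ∀ {n} → SignedPerm n → ℕ → (ℕ → A) → A
  DB {n} π K z =
    Σ (map (λ a → if validFrom π 0 t0 a then Π (map (λ t → z (absT t)) a) else 0#)
           (tuples n (lettersUpTo K)))

  monoTail : ℕ → (ℕ → A) → List ℕ → List ℕ → A
  monoTail n z (s ∷ ss) (i ∷ is) = pow (z i) (nxt ss ∸ s) * monoTail n z ss is
    where
      nxt : List ℕ → ℕ
      nxt []       = n
      nxt (s' ∷ _) = s'
  monoTail n z _ _ = 1#

  firstOr : ℕ → List ℕ → ℕ
  firstOr n []      = n
  firstOr n (s ∷ _) = s

  N : ℕ → ℕ → (ℕ → A) → List Bool → A
  N n K z S =
    Σ (map (λ is → pow (z 0) (firstOr n (elems S)) * monoTail n z (elems S) is)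
           (choose (map suc (upTo K)) (length (elems S))))

  L : ℕ → ℕ → (ℕ → A) → List Bool → A
  L n K z S = Σ (map (λ U → if subsetB S U then N n K z U else 0#) (subsets n))

  two^ : ℕ → A
  two^ = pow (1# + 1#)

  RHS : ∀ {n} → SignedPerm n → ℕ → (ℕ → A) → A
  RHS {n} π K z =
    two^ (peB π ℕ.+ ς π) *
    Σ (map (λ D → if condD π D then L n K z D else 0#) (subsets n))

{-# OPTIONS --safe #-}
module Submission where

-- Both sides are computed by scanning the steps 0, …, n-1 from left to right (a transfer matrix).
-- On the left the state is the last letter. On the right one writes L_D = Σ_{U ⊇ D} N_U and sums
-- over pairs D ⊆ U together with a weakly increasing value sequence whose strict ascents are U;
-- the state is the current value, whether the previous step lies in D and whether it is a descent.
-- Writing Pe_B together with 0 (when π(1) < 0) as the set of steps s that are descents while s - 1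
-- is not, the condition on D and the factor 2^{pe_B + ς} become local: each such step contributes
-- a factor 2 and demands that exactly one of s - 1, s lies in D. The two scans agree because, after
-- an ascent, the sign of the last letter plays the role of "the previous step lies in D", while after
-- a descent the right-hand state forgets D and the two signs of the last letter together account for
-- the factor 2.

open import Defs
open import Data.Nat using (ℕ; _≤_)
open import Algebra.Bundles using (CommutativeSemiring)

open import Data.Bool using (Bool; true; false; not; _∧_; _∨_; _xor_; if_then_else_)
open import Data.Bool.Properties using (∧-comm; xor-comm)
open import Data.Fin using (fromℕ<; toℕ)
open import Data.Fin.Properties using (toℕ-fromℕ<)
open import Data.Integer as ℤ using (∣_∣)
import Data.Integer.Properties as ℤ
open import Data.List using (List; []; _∷_; map; concatMap; foldr; length; upTo; applyUpTo; filterᵇ; drop; _++_)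
import Data.List.Properties as List
open import Data.Nat as ℕ using (zero; suc; _∸_; _<_; _<?_; s≤s; z≤n)
import Data.Nat.Properties as ℕ
open import Data.Product using (proj₁)
open import Function using (_∘_)
open import Level using (Level)
open import Relation.Binary.Definitions using (tri<; tri≈; tri>)
import Relation.Binary.PropositionalEquality as ≡
open ≡ using (_≡_; _≢_)
open import Relation.Nullary using (Dec; ¬_; contradiction)
open import Relation.Nullary.Decidable using (⌊_⌋; yes; no; isYes≗does; dec-true; dec-false)

range : ℕ → ℕ → List ℕ
range s zero    = []
range s (suc m) = s ∷ range (suc s) m

map-suc-range : ∀ s m → map suc (range s m) ≡ range (suc s) m
map-suc-range s zero    = ≡.refl
map-suc-range s (suc m) = ≡.cong (suc s ∷_) (map-suc-range (suc s) m)

upTo≡range : ∀ m → upTo m ≡ range 0 m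
upTo≡range zero    = ≡.refl
upTo≡range (suc m) = ≡.cong (0 ∷_) (begin
  applyUpTo suc m     ≡⟨ List.map-upTo suc m ⟨
  map suc (upTo m)    ≡⟨ ≡.cong (map suc) (upTo≡range m) ⟩
  map suc (range 0 m) ≡⟨ map-suc-range 0 m ⟩
  range 1 m           ∎)
  where open ≡.≡-Reasoning

range-++ : ∀ s m n → range s (m ℕ.+ n) ≡ range s m ++ range (s ℕ.+ m) n
range-++ s zero    n = ≡.cong (λ t → range t n) (≡.sym (ℕ.+-identityʳ s))
range-++ s (suc m) n = ≡.cong (s ∷_) (≡.trans (range-++ (suc s) m n)
                                              (≡.cong (λ t → range (suc s) m ++ range t n) (≡.sym (ℕ.+-suc s m))))

⌊⌋-true : ∀ {a} {X : Set a} (d : Dec X) → X → ⌊ d ⌋ ≡ true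
⌊⌋-true d x = ≡.trans (isYes≗does d) (dec-true d x)

⌊⌋-false : ∀ {a} {X : Set a} (d : Dec X) → ¬ X → ⌊ d ⌋ ≡ false
⌊⌋-false d ¬x = ≡.trans (isYes≗does d) (dec-false d ¬x)

<?-flip : ∀ {a b} → a ≢ b → ⌊ a ℤ.<? b ⌋ ≡ not ⌊ b ℤ.<? a ⌋
<?-flip {a} {b} a≢b with ℤ.<-cmp a b
... | tri< a<b _ _ rewrite ⌊⌋-true (a ℤ.<? b) a<b | ⌊⌋-false (b ℤ.<? a) (ℤ.<-asym a<b) = ≡.refl
... | tri≈ _ a≡b _ = contradiction a≡b a≢b
... | tri> _ _ b<a rewrite ⌊⌋-false (a ℤ.<? b) (ℤ.<-asym b<a) | ⌊⌋-true (b ℤ.<? a) b<a = ≡.refl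

module _ {n} (π : SignedPerm n) where
  open SignedPerm π

  val-suc : ∀ {i} (i<n : i < n) → val π (suc i) ≡ w (fromℕ< i<n)
  val-suc {i} i<n with i <? n
  ... | yes _   = ≡.refl
  ... | no i≮n = contradiction i<n i≮n

  val-≢-suc : ∀ k → suc k < n → val π k ≢ val π (suc k)
  val-≢-suc zero 1<n v₀≡v₁ = ℕ.<-irrefl ≡.refl (≡.subst (1 ≤_) ∣w₀∣≡0 (proj₁ (inRange (fromℕ< 0<n))))
    where
      0<n : 0 < n
      0<n = ℕ.<-trans (ℕ.n<1+n 0) 1<n
      ∣w₀∣≡0 : ∣ w (fromℕ< 0<n) ∣ ≡ 0
      ∣w₀∣≡0 = ≡.cong ∣_∣ (≡.trans (≡.sym (val-suc 0<n)) (≡.sym v₀≡v₁))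
  val-≢-suc (suc k) k+2<n vₖ≡vₖ₊₁ = ℕ.1+n≢n (≡.sym (begin
    k                    ≡⟨ toℕ-fromℕ< k<n ⟨
    toℕ (fromℕ< k<n)     ≡⟨ ≡.cong toℕ (absInj (≡.cong ∣_∣ wₖ≡wₖ₊₁)) ⟩
    toℕ (fromℕ< k+1<n)   ≡⟨ toℕ-fromℕ< k+1<n ⟩
    suc k                ∎))
    where
      open ≡.≡-Reasoning
      k+1<n : suc k < n
      k+1<n = ℕ.<-trans (ℕ.n<1+n (suc k)) k+2<n
      k<n : k < n
      k<n = ℕ.<-trans (ℕ.n<1+n k) k+1<n
      wₖ≡wₖ₊₁ : w (fromℕ< k<n) ≡ w (fromℕ< k+1<n)
      wₖ≡wₖ₊₁ = ≡.trans (≡.sym (val-suc k<n)) (≡.trans vₖ≡vₖ₊₁ (val-suc k+1<n))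

-- Step s is a peak step when s - 1 is not a descent and s is, step -1 counting as an ascent:
-- the peak steps are Pe_B, together with 0 when π(1) < 0.
peakStep : Bool → Bool → Bool
peakStep p b = not p ∧ b

isPeak-suc : ∀ {n} (π : SignedPerm n) k → suc k < n →
             isPeak π (suc k) ≡ peakStep (isDes π k) (isDes π (suc k))
isPeak-suc {n} π k k+1<n
  rewrite ⌊⌋-true (suc k <? n) k+1<n | <?-flip (val-≢-suc π k k+1<n) = ≡.refl

descentWord : ∀ {n} → SignedPerm n → ℕ → ℕ → List Bool
descentWord π s zero    = []
descentWord π s (suc m) = isDes π s ∷ descentWord π (suc s) m

length-descentWord : ∀ {n} (π : SignedPerm n) s m → length (descentWord π s m) ≡ m
length-descentWord π s zero    = ≡.refl
length-descentWord π s (suc m) = ≡.cong suc (length-descentWord π (suc s) m)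

peakCount : Bool → List Bool → ℕ
peakCount p []       = 0
peakCount p (b ∷ ds) = (if peakStep p b then 1 else 0) ℕ.+ peakCount b ds

length-filterᵇ-∷ : ∀ (P : ℕ → Bool) x xs →
                   length (filterᵇ P (x ∷ xs)) ≡ (if P x then 1 else 0) ℕ.+ length (filterᵇ P xs)
length-filterᵇ-∷ P x xs with P x
... | true  = ≡.refl
... | false = ≡.refl

s+1<n : ∀ {n} s m → suc s ℕ.+ suc m ≤ n → suc s < n
s+1<n s m s+m+2≤n = ℕ.<-≤-trans (ℕ.m<m+n (suc s) (s≤s z≤n)) s+m+2≤n

peaks≡peakCount : ∀ {n} (π : SignedPerm n) s m → suc s ℕ.+ m ≤ n →
  length (filterᵇ (isPeak π) (range (suc s) m)) ≡ peakCount (isDes π s) (descentWord π (suc s) m)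
peaks≡peakCount π s zero    _ = ≡.refl
peaks≡peakCount {n} π s (suc m) s+m+2≤n =
  ≡.trans (length-filterᵇ-∷ (isPeak π) (suc s) (range (suc (suc s)) m))
          (≡.cong₂ (λ c r → (if c then 1 else 0) ℕ.+ r)
                   (isPeak-suc π s (s+1<n s m s+m+2≤n))
                   (peaks≡peakCount π (suc s) m (≡.subst (_≤ n) (ℕ.+-suc (suc s) m) s+m+2≤n)))

peB+ς≡peakCount : ∀ {n} (π : SignedPerm n) → 1 ≤ n → peB π ℕ.+ ς π ≡ peakCount false (descentWord π 0 n)
peB+ς≡peakCount {suc n} π _ = begin
  peB π ℕ.+ ς π
    ≡⟨ ℕ.+-comm (peB π) (ς π) ⟩
  ς π ℕ.+ length (filterᵇ (isPeak π) (upTo (suc n)))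
    ≡⟨ ≡.cong (λ xs → ς π ℕ.+ length (filterᵇ (isPeak π) xs)) (upTo≡range (suc n)) ⟩
  ς π ℕ.+ length (filterᵇ (isPeak π) (range 1 n))
    ≡⟨ ≡.cong (ς π ℕ.+_) (peaks≡peakCount π 0 n ℕ.≤-refl) ⟩
  peakCount false (descentWord π 0 (suc n)) ∎
  where open ≡.≡-Reasoning

-- e records whether the previous step lies in D (step -1 does not), p whether it is a descent.
allowed : Bool → Bool → Bool → Bool → Bool
allowed e p b d = not (peakStep p b) ∨ (e xor d)

separated : Bool → Bool → List Bool → List Bool → Bool
separated e p []       D = true
separated e p (b ∷ ds) D = allowed e p b (memB 0 D) ∧ separated (memB 0 D) b ds (drop 1 D)

memB-drop : ∀ k D → memB 0 (drop k D) ≡ memB k D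
memB-drop zero    D       = ≡.refl
memB-drop (suc k) []      = ≡.refl
memB-drop (suc k) (_ ∷ D) = memB-drop k D

drop-1-drop : ∀ k (D : List Bool) → drop 1 (drop k D) ≡ drop (suc k) D
drop-1-drop zero    D       = ≡.refl
drop-1-drop (suc k) []      = ≡.refl
drop-1-drop (suc k) (_ ∷ D) = drop-1-drop k D

foldr-∧-filterᵇ : ∀ (P f : ℕ → Bool) xs →
  foldr (λ i r → f i ∧ r) true (filterᵇ P xs) ≡ foldr (λ i r → (not (P i) ∨ f i) ∧ r) true xs
foldr-∧-filterᵇ P f []       = ≡.refl
foldr-∧-filterᵇ P f (x ∷ xs) with P x
... | true  = ≡.cong (f x ∧_) (foldr-∧-filterᵇ P f xs)
... | false = foldr-∧-filterᵇ P f xs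

module _ {n} (π : SignedPerm n) (D : List Bool) where

  peaksSeparatedOn : List ℕ → Bool
  peaksSeparatedOn = foldr (λ i r → (not (isPeak π i) ∨ (memB i D xor memB (i ∸ 1) D)) ∧ r) true

  peaksSeparatedOn≡separated : ∀ s m → suc s ℕ.+ m ≤ n →
    peaksSeparatedOn (range (suc s) m)
      ≡ separated (memB s D) (isDes π s) (descentWord π (suc s) m) (drop (suc s) D)
  peaksSeparatedOn≡separated s zero    _ = ≡.refl
  peaksSeparatedOn≡separated s (suc m) s+m+2≤n
    rewrite isPeak-suc π s (s+1<n s m s+m+2≤n)
          | memB-drop (suc s) D | drop-1-drop (suc s) D | xor-comm (memB (suc s) D) (memB s D) =
    ≡.cong (allowed (memB s D) (isDes π s) (isDes π (suc s)) (memB (suc s) D) ∧_)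
           (peaksSeparatedOn≡separated (suc s) m (≡.subst (_≤ n) (ℕ.+-suc (suc s) m) s+m+2≤n))

condD≡separated : ∀ {n} (π : SignedPerm n) → 1 ≤ n → ∀ D → condD π D ≡ separated false false (descentWord π 0 n) D
condD≡separated {suc n} π _ D = begin
  condD π D
    ≡⟨ ≡.cong (_∧ first) (foldr-∧-filterᵇ (isPeak π) (λ i → memB i D xor memB (i ∸ 1) D) (upTo (suc n))) ⟩
  peaksSeparatedOn π D (upTo (suc n)) ∧ first
    ≡⟨ ≡.cong (λ xs → peaksSeparatedOn π D xs ∧ first) (upTo≡range (suc n)) ⟩
  peaksSeparatedOn π D (range 1 n) ∧ first
    ≡⟨ ≡.cong (_∧ first) (peaksSeparatedOn≡separated π D 0 n ℕ.≤-refl) ⟩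
  separated (memB 0 D) (isDes π 0) (descentWord π 1 n) (drop 1 D) ∧ first
    ≡⟨ ∧-comm _ first ⟩
  separated false false (descentWord π 0 (suc n)) D ∎
  where
    open ≡.≡-Reasoning
    first : Bool
    first = allowed false false (isDes π 0) (memB 0 D)

_≤[_]_ : T∞ → Bool → T∞ → Bool
x ≤[ b ] y = if b then x ≤⁻ y else x ≤⁺ y

≤[]-< : ∀ b {x y} → rank x < rank y → x ≤[ b ] y ≡ true
≤[]-< true  {x} {y} rx<ry rewrite ⌊⌋-true (rank x <? rank y) rx<ry = ≡.refl
≤[]-< false {x} {y} rx<ry rewrite ⌊⌋-true (rank x <? rank y) rx<ry = ≡.refl

≤[]-> : ∀ b {x y} → rank y < rank x → x ≤[ b ] y ≡ false
≤[]-> true  {x} {y} ry<rx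
  rewrite ⌊⌋-false (rank x <? rank y) (ℕ.<-asym ry<rx) | ⌊⌋-false (rank x ℕ.≟ rank y) (ℕ.>⇒≢ ry<rx) = ≡.refl
≤[]-> false {x} {y} ry<rx
  rewrite ⌊⌋-false (rank x <? rank y) (ℕ.<-asym ry<rx) | ⌊⌋-false (rank x ℕ.≟ rank y) (ℕ.>⇒≢ ry<rx) = ≡.refl

≤[]-refl : ∀ b x → x ≤[ b ] x ≡ (if b then not (εpos x) else εpos x)
≤[]-refl true  x
  rewrite ⌊⌋-false (rank x <? rank x) (ℕ.<-irrefl ≡.refl) | ⌊⌋-true (rank x ℕ.≟ rank x) ≡.refl = ≡.refl
≤[]-refl false x
  rewrite ⌊⌋-false (rank x <? rank x) (ℕ.<-irrefl ≡.refl) | ⌊⌋-true (rank x ℕ.≟ rank x) ≡.refl = ≡.refl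

≤[]-refl-tpos : ∀ b k → tpos k ≤[ b ] tpos k ≡ not b
≤[]-refl-tpos true  k = ≤[]-refl true  (tpos k)
≤[]-refl-tpos false k = ≤[]-refl false (tpos k)

≤[]-refl-tneg : ∀ b k → tneg k ≤[ b ] tneg k ≡ b
≤[]-refl-tneg true  k = ≤[]-refl true  (tneg k)
≤[]-refl-tneg false k = ≤[]-refl false (tneg k)

rank-tneg<tpos : ∀ k → rank (tneg k) < rank (tpos k)
rank-tneg<tpos k = ℕ.n<1+n _

rank-tpos<tneg : ∀ {i k} → i < k → rank (tpos i) < rank (tneg k)
rank-tpos<tneg {i} {k} i<k = s≤s (≡.subst (_≤ 2 ℕ.* k) (ℕ.*-suc 2 i) (ℕ.*-monoʳ-≤ 2 i<k))

module WithSemiring {c ℓ} (R : CommutativeSemiring c ℓ) where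
  open CommutativeSemiring R renaming (Carrier to A)
  open Eval R
  open import Relation.Binary.Reasoning.Setoid setoid
  open import Algebra.Solver.Ring.NaturalCoefficients.Default R

  private variable
    b d : Level
    B : Set b
    C : Set d

  ≡⇒≈ : ∀ {x y} → x ≡ y → x ≈ y
  ≡⇒≈ ≡.refl = refl

  Σ-++ : ∀ xs ys → Σ (xs ++ ys) ≈ Σ xs + Σ ys
  Σ-++ []       ys = sym (+-identityˡ _)
  Σ-++ (x ∷ xs) ys = trans (+-congˡ (Σ-++ xs ys)) (sym (+-assoc _ _ _))

  Σ-map-cong : ∀ {f g : B → A} xs → (∀ x → f x ≈ g x) → Σ (map f xs) ≈ Σ (map g xs)
  Σ-map-cong []       f≈g = refl
  Σ-map-cong (x ∷ xs) f≈g = +-cong (f≈g x) (Σ-map-cong xs f≈g)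

  Σ-map-++ : ∀ (f : B → A) xs ys → Σ (map f (xs ++ ys)) ≈ Σ (map f xs) + Σ (map f ys)
  Σ-map-++ f xs ys = trans (≡⇒≈ (≡.cong Σ (List.map-++ f xs ys))) (Σ-++ (map f xs) (map f ys))

  Σ-map-+ : ∀ (f g : B → A) xs → Σ (map (λ x → f x + g x) xs) ≈ Σ (map f xs) + Σ (map g xs)
  Σ-map-+ f g []       = sym (+-identityˡ 0#)
  Σ-map-+ f g (x ∷ xs) = trans (+-congˡ (Σ-map-+ f g xs))
    (solve 4 (λ a b c d → (a :+ b) :+ (c :+ d) := (a :+ c) :+ (b :+ d)) refl (f x) (g x) _ _)

  Σ-map-*ˡ : ∀ k (f : B → A) xs → Σ (map (λ x → k * f x) xs) ≈ k * Σ (map f xs)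
  Σ-map-*ˡ k f []       = sym (zeroʳ k)
  Σ-map-*ˡ k f (x ∷ xs) = trans (+-congˡ (Σ-map-*ˡ k f xs)) (sym (distribˡ k _ _))

  Σ-map-0 : ∀ (xs : List B) → Σ (map (λ _ → 0#) xs) ≈ 0#
  Σ-map-0 []       = refl
  Σ-map-0 (x ∷ xs) = trans (+-congˡ (Σ-map-0 xs)) (+-identityˡ 0#)

  Σ-map-∘ : ∀ (f : C → A) (g : B → C) xs → Σ (map f (map g xs)) ≈ Σ (map (f ∘ g) xs)
  Σ-map-∘ f g xs = ≡⇒≈ (≡.cong Σ (≡.sym (List.map-∘ xs)))

  Σ-concatMap : ∀ (f : C → A) (g : B → List C) xs →
                Σ (map f (concatMap g xs)) ≈ Σ (map (λ x → Σ (map f (g x))) xs)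
  Σ-concatMap f g []       = refl
  Σ-concatMap f g (x ∷ xs) = trans (Σ-map-++ f (g x) (concatMap g xs)) (+-congˡ (Σ-concatMap f g xs))

  Σ-range-cong : ∀ {f g : ℕ → A} s m → (∀ i → s ≤ i → i < s ℕ.+ m → f i ≈ g i) →
                 Σ (map f (range s m)) ≈ Σ (map g (range s m))
  Σ-range-cong s zero    f≈g = refl
  Σ-range-cong s (suc m) f≈g =
    +-cong (f≈g s ℕ.≤-refl (ℕ.m<m+n s (s≤s z≤n)))
           (Σ-range-cong (suc s) m (λ i s<i i<s+m → f≈g i (ℕ.<⇒≤ s<i) (≡.subst (i <_) (≡.sym (ℕ.+-suc s m)) i<s+m)))

  Σ-tuples-suc : ∀ m xs (f : List B → A) →
                 Σ (map f (tuples (suc m) xs)) ≈ Σ (map (λ x → Σ (map (f ∘ (x ∷_)) (tuples m xs))) xs)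
  Σ-tuples-suc m xs f = trans (Σ-concatMap f (λ x → map (x ∷_) (tuples m xs)) xs)
                              (Σ-map-cong xs (λ x → Σ-map-∘ f (x ∷_) (tuples m xs)))

  Σ-tuples-cong : ∀ m xs {f g : List B → A} → (∀ a → length a ≡ m → f a ≈ g a) →
                  Σ (map f (tuples m xs)) ≈ Σ (map g (tuples m xs))
  Σ-tuples-cong zero    xs f≈g = +-congʳ (f≈g [] ≡.refl)
  Σ-tuples-cong (suc m) xs {f} {g} f≈g = begin
    Σ (map f (tuples (suc m) xs))
      ≈⟨ Σ-tuples-suc m xs f ⟩
    Σ (map (λ x → Σ (map (f ∘ (x ∷_)) (tuples m xs))) xs)
      ≈⟨ Σ-map-cong xs (λ x → Σ-tuples-cong m xs (λ a ∣a∣≡m → f≈g (x ∷ a) (≡.cong suc ∣a∣≡m))) ⟩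
    Σ (map (λ x → Σ (map (g ∘ (x ∷_)) (tuples m xs))) xs)
      ≈⟨ Σ-tuples-suc m xs g ⟨
    Σ (map g (tuples (suc m) xs)) ∎

  if-cong : ∀ c {x y} → x ≈ y → (if c then x else 0#) ≈ (if c then y else 0#)
  if-cong true  x≈y = x≈y
  if-cong false _   = refl

  if-+ : ∀ c x y → (if c then x + y else 0#) ≈ (if c then x else 0#) + (if c then y else 0#)
  if-+ true  x y = refl
  if-+ false x y = sym (+-identityˡ 0#)

  if-*ˡ : ∀ c k x → (if c then k * x else 0#) ≈ k * (if c then x else 0#)
  if-*ˡ true  k x = refl
  if-*ˡ false k x = sym (zeroʳ k)

  if-0 : ∀ c → (if c then 0# else 0#) ≈ 0#
  if-0 true  = refl
  if-0 false = refl

  ΣIf : (B → Bool) → List B → (B → A) → A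
  ΣIf c xs f = Σ (map (λ x → if c x then f x else 0#) xs)

  ΣIf-cong : ∀ {c c′ : B → Bool} {f g : B → A} xs → (∀ x → c x ≡ c′ x) → (∀ x → f x ≈ g x) →
             ΣIf c xs f ≈ ΣIf c′ xs g
  ΣIf-cong {c′ = c′} {f} xs c≡c′ f≈g = Σ-map-cong xs (λ x →
    trans (≡⇒≈ (≡.cong (λ t → if t then f x else 0#) (c≡c′ x))) (if-cong (c′ x) (f≈g x)))

  ΣIf-congʳ : ∀ (c : B → Bool) {f g : B → A} xs → (∀ x → f x ≈ g x) → ΣIf c xs f ≈ ΣIf c xs g
  ΣIf-congʳ c xs = ΣIf-cong xs (λ _ → ≡.refl)

  ΣIf-+ : ∀ (c : B → Bool) xs f g → ΣIf c xs (λ x → f x + g x) ≈ ΣIf c xs f + ΣIf c xs g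
  ΣIf-+ c xs f g = trans (Σ-map-cong xs (λ x → if-+ (c x) (f x) (g x)))
                         (Σ-map-+ (λ x → if c x then f x else 0#) (λ x → if c x then g x else 0#) xs)

  ΣIf-*ˡ : ∀ (c : B → Bool) xs k f → ΣIf c xs (λ x → k * f x) ≈ k * ΣIf c xs f
  ΣIf-*ˡ c xs k f = trans (Σ-map-cong xs (λ x → if-*ˡ (c x) k (f x)))
                          (Σ-map-*ˡ k (λ x → if c x then f x else 0#) xs)

  ΣIf-0 : ∀ (c : B → Bool) xs → ΣIf c xs (λ _ → 0#) ≈ 0#
  ΣIf-0 c xs = trans (Σ-map-cong xs (λ x → if-0 (c x))) (Σ-map-0 xs)

  ΣIf-∧ : ∀ a (c : B → Bool) xs f → ΣIf (λ x → a ∧ c x) xs f ≈ (if a then ΣIf c xs f else 0#)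
  ΣIf-∧ true  c xs f = refl
  ΣIf-∧ false c xs f = Σ-map-0 xs

  ΣIf-subsets-suc : ∀ m c f → ΣIf c (subsets (suc m)) f ≈
    ΣIf (c ∘ (false ∷_)) (subsets m) (f ∘ (false ∷_)) + ΣIf (c ∘ (true ∷_)) (subsets m) (f ∘ (true ∷_))
  ΣIf-subsets-suc m c f = trans (Σ-tuples-suc m (false ∷ true ∷ []) _) (+-congˡ (+-identityʳ _))

  ΣIf-subsets-cong : ∀ m c {f g : List Bool → A} → (∀ U → length U ≡ m → f U ≈ g U) →
                     ΣIf c (subsets m) f ≈ ΣIf c (subsets m) g
  ΣIf-subsets-cong m c f≈g = Σ-tuples-cong m (false ∷ true ∷ []) (λ U ∣U∣≡m → if-cong (c U) (f≈g U ∣U∣≡m))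

  pow-+ : ∀ x m n → pow x (m ℕ.+ n) ≈ pow x m * pow x n
  pow-+ x zero    n = sym (*-identityˡ _)
  pow-+ x (suc m) n = trans (*-congˡ (pow-+ x m n)) (sym (*-assoc _ _ _))

  double : Bool → A → A
  double true  x = x + x
  double false x = x

  two^-indicator : ∀ c x → two^ (if c then 1 else 0) * x ≈ double c x
  two^-indicator true  x = begin
    ((1# + 1#) * 1#) * x ≈⟨ *-congʳ (*-identityʳ _) ⟩
    (1# + 1#) * x        ≈⟨ distribʳ x 1# 1# ⟩
    1# * x + 1# * x      ≈⟨ +-cong (*-identityˡ x) (*-identityˡ x) ⟩
    x + x                ∎
  two^-indicator false x = *-identityˡ x

  module Truncated (K : ℕ) (z : ℕ → A) where

    -- Left-hand side: valid words over T∞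

    letters : List T∞
    letters = lettersUpTo K

    step : Bool → T∞ → (T∞ → A) → T∞ → A
    step b x V y = if x ≤[ b ] y then z (absT y) * V y else 0#

    transfer : Bool → T∞ → (T∞ → A) → A
    transfer b x V = Σ (map (step b x V) letters)

    wordSum : List Bool → T∞ → A
    wordSum []       x = 1#
    wordSum (b ∷ ds) x = transfer b x (wordSum ds)

    validSum≈wordSum : ∀ {n} (π : SignedPerm n) s m x →
      ΣIf (validFrom π s x) (tuples m letters) (λ a → Π (map (λ t → z (absT t)) a)) ≈ wordSum (descentWord π s m) x
    validSum≈wordSum π s zero    x = +-identityʳ 1#
    validSum≈wordSum π s (suc m) x = trans (Σ-tuples-suc m letters _) (Σ-map-cong letters λ y → begin
      ΣIf (λ a → (x ≤[ isDes π s ] y) ∧ validFrom π (suc s) y a) (tuples m letters) (λ a → z (absT y) * weight a)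
        ≈⟨ ΣIf-∧ (x ≤[ isDes π s ] y) (validFrom π (suc s) y) (tuples m letters) _ ⟩
      (if x ≤[ isDes π s ] y then ΣIf (validFrom π (suc s) y) (tuples m letters) (λ a → z (absT y) * weight a) else 0#)
        ≈⟨ if-cong (x ≤[ isDes π s ] y) (trans (ΣIf-*ˡ (validFrom π (suc s) y) (tuples m letters) (z (absT y)) weight)
                                              (*-congˡ (validSum≈wordSum π (suc s) m y))) ⟩
      step (isDes π s) x (wordSum (descentWord π (suc s) m)) y ∎)
      where
        weight : List T∞ → A
        weight a = Π (map (λ t → z (absT t)) a)

    pairStep : Bool → T∞ → (T∞ → A) → ℕ → A
    pairStep b x V k = step b x V (tneg k) + (step b x V (tpos k) + 0#)

    above : (T∞ → A) → ℕ → ℕ → A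
    above V s m = Σ (map (λ k → z (suc k) * (V (tneg k) + V (tpos k))) (range s m))

    transfer-letters : ∀ b x V → transfer b x V ≈ step b x V t0 + Σ (map (pairStep b x V) (range 0 K))
    transfer-letters b x V = +-congˡ (trans (Σ-concatMap (step b x V) (λ k → tneg k ∷ tpos k ∷ []) (upTo K))
                                            (≡⇒≈ (≡.cong (λ ks → Σ (map (pairStep b x V) ks)) (upTo≡range K))))

    step-below : ∀ b x V {y} → rank y < rank x → step b x V y ≈ 0#
    step-below b x V {y} ry<rx = ≡⇒≈ (≡.cong (λ t → if t then z (absT y) * V y else 0#) (≤[]-> b {x} {y} ry<rx))

    step-above : ∀ b x V {y} → rank x < rank y → step b x V y ≈ z (absT y) * V y
    step-above b x V {y} rx<ry = ≡⇒≈ (≡.cong (λ t → if t then z (absT y) * V y else 0#) (≤[]-< b {x} {y} rx<ry))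

    step-self : ∀ b x V {c} → x ≤[ b ] x ≡ c → step b x V x ≈ (if c then z (absT x) * V x else 0#)
    step-self b x V x≤x≡c = ≡⇒≈ (≡.cong (λ t → if t then z (absT x) * V x else 0#) x≤x≡c)

    pairStep-below : ∀ b x V {k} → rank (tpos k) < rank x → pairStep b x V k ≈ 0#
    pairStep-below b x V {k} r⁺<rx = begin
      step b x V (tneg k) + (step b x V (tpos k) + 0#)
        ≈⟨ +-cong (step-below b x V (ℕ.<-trans (rank-tneg<tpos k) r⁺<rx)) (+-congʳ (step-below b x V r⁺<rx)) ⟩
      0# + (0# + 0#)
        ≈⟨ trans (+-identityˡ _) (+-identityˡ 0#) ⟩
      0# ∎

    pairStep-above : ∀ b x V {k} → rank x < rank (tneg k) → pairStep b x V k ≈ z (suc k) * (V (tneg k) + V (tpos k))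
    pairStep-above b x V {k} rx<r⁻ = begin
      step b x V (tneg k) + (step b x V (tpos k) + 0#)
        ≈⟨ +-cong (step-above b x V rx<r⁻) (+-congʳ (step-above b x V (ℕ.<-trans rx<r⁻ (rank-tneg<tpos k)))) ⟩
      z (suc k) * V (tneg k) + (z (suc k) * V (tpos k) + 0#)
        ≈⟨ solve 3 (λ a n p → a :* n :+ (a :* p :+ con 0) := a :* (n :+ p)) refl (z (suc k)) (V (tneg k)) (V (tpos k)) ⟩
      z (suc k) * (V (tneg k) + V (tpos k)) ∎

    transfer-level : ∀ b x V k m → k ℕ.+ suc m ≡ K → rank (tneg k) ≤ rank x → rank x ≤ rank (tpos k) →
                     transfer b x V ≈ pairStep b x V k + above V (suc k) m
    transfer-level b x V k m k+m+1≡K r⁻≤rx rx≤r⁺ = begin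
      transfer b x V
        ≈⟨ transfer-letters b x V ⟩
      step b x V t0 + Σ (map (pairStep b x V) (range 0 K))
        ≡⟨ ≡.cong (λ ks → step b x V t0 + Σ (map (pairStep b x V) ks))
                  (≡.trans (≡.cong (range 0) (≡.sym k+m+1≡K)) (range-++ 0 k (suc m))) ⟩
      step b x V t0 + Σ (map (pairStep b x V) (range 0 k ++ k ∷ range (suc k) m))
        ≈⟨ +-cong (step-below b x V (ℕ.<-≤-trans (s≤s z≤n) r⁻≤rx)) (Σ-map-++ (pairStep b x V) (range 0 k) _) ⟩
      0# + (Σ (map (pairStep b x V) (range 0 k)) + (pairStep b x V k + Σ (map (pairStep b x V) (range (suc k) m))))
        ≈⟨ trans (+-identityˡ _) (trans (+-cong below≈0 (+-congˡ above≈)) (+-identityˡ _)) ⟩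
      pairStep b x V k + above V (suc k) m ∎
      where
        below≈0 : Σ (map (pairStep b x V) (range 0 k)) ≈ 0#
        below≈0 = trans (Σ-range-cong 0 k (λ i _ i<k → pairStep-below b x V (ℕ.<-≤-trans (rank-tpos<tneg i<k) r⁻≤rx)))
                        (Σ-map-0 (range 0 k))
        above≈ : Σ (map (pairStep b x V) (range (suc k) m)) ≈ above V (suc k) m
        above≈ = Σ-range-cong (suc k) m (λ i k<i _ → pairStep-above b x V (ℕ.≤-<-trans rx≤r⁺ (rank-tpos<tneg k<i)))

    transfer-t0 : ∀ b V → transfer b t0 V ≈ (if not b then z 0 * V t0 else 0#) + above V 0 K
    transfer-t0 b V = trans (transfer-letters b t0 V)
      (+-cong (step-self b t0 V (t0≤t0 b)) (Σ-range-cong 0 K (λ i _ _ → pairStep-above b t0 V (s≤s z≤n))))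
      where
        t0≤t0 : ∀ b → t0 ≤[ b ] t0 ≡ not b
        t0≤t0 true  = ≡.refl
        t0≤t0 false = ≡.refl

    transfer-tpos : ∀ b V k m → k ℕ.+ suc m ≡ K →
                    transfer b (tpos k) V ≈ (if not b then z (suc k) * V (tpos k) else 0#) + above V (suc k) m
    transfer-tpos b V k m k+m+1≡K = begin
      transfer b (tpos k) V
        ≈⟨ transfer-level b (tpos k) V k m k+m+1≡K (ℕ.<⇒≤ (rank-tneg<tpos k)) ℕ.≤-refl ⟩
      (step b (tpos k) V (tneg k) + (step b (tpos k) V (tpos k) + 0#)) + above V (suc k) m
        ≈⟨ +-congʳ (+-cong (step-below b (tpos k) V (rank-tneg<tpos k))
                           (trans (+-identityʳ _) (step-self b (tpos k) V (≤[]-refl-tpos b k)))) ⟩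
      (0# + (if not b then z (suc k) * V (tpos k) else 0#)) + above V (suc k) m
        ≈⟨ +-congʳ (+-identityˡ _) ⟩
      (if not b then z (suc k) * V (tpos k) else 0#) + above V (suc k) m ∎

    transfer-tneg : ∀ b V k m → k ℕ.+ suc m ≡ K →
      transfer b (tneg k) V ≈ (if b then z (suc k) * V (tneg k) else 0#) + (z (suc k) * V (tpos k) + above V (suc k) m)
    transfer-tneg b V k m k+m+1≡K = begin
      transfer b (tneg k) V
        ≈⟨ transfer-level b (tneg k) V k m k+m+1≡K ℕ.≤-refl (ℕ.<⇒≤ (rank-tneg<tpos k)) ⟩
      (step b (tneg k) V (tneg k) + (step b (tneg k) V (tpos k) + 0#)) + above V (suc k) m
        ≈⟨ +-congʳ (+-cong (step-self b (tneg k) V (≤[]-refl-tneg b k))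
                           (+-congʳ (step-above b (tneg k) V (rank-tneg<tpos k)))) ⟩
      ((if b then z (suc k) * V (tneg k) else 0#) + (z (suc k) * V (tpos k) + 0#)) + above V (suc k) m
        ≈⟨ solve 3 (λ s p a → (s :+ (p :+ con 0)) :+ a := s :+ (p :+ a)) refl _ _ _ ⟩
      (if b then z (suc k) * V (tneg k) else 0#) + (z (suc k) * V (tpos k) + above V (suc k) m) ∎

    -- signedSum ds neg j vs sums the words following a letter of absolute value j (negative iff neg)
    -- whose later absolute values lie in j ∷ vs; risingSum ds vs those whose first letter has its
    -- absolute value in vs. The letter t0 is the positive letter of value 0.
    mutual
      signedSum : List Bool → Bool → ℕ → List ℕ → A
      signedSum []       _     _ _  = 1#
      signedSum (b ∷ ds) false j vs = (if not b then z j * signedSum ds false j vs else 0#) + risingSum ds vs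
      signedSum (b ∷ ds) true  j vs =
        (if b then z j * signedSum ds true j vs else 0#) + (z j * signedSum ds false j vs + risingSum ds vs)

      risingSum : List Bool → List ℕ → A
      risingSum ds []       = 0#
      risingSum ds (v ∷ vs) = z v * (signedSum ds true v vs + signedSum ds false v vs) + risingSum ds vs

    mutual
      wordSum≈signedSum : ∀ ds x m → absT x ℕ.+ m ≡ K →
                          wordSum ds x ≈ signedSum ds (not (εpos x)) (absT x) (range (suc (absT x)) m)
      wordSum≈signedSum []       x        m _ = refl
      wordSum≈signedSum (b ∷ ds) t0       m ≡.refl = trans (transfer-t0 b (wordSum ds))
        (+-cong (if-cong (not b) (*-congˡ (wordSum≈signedSum ds t0 m ≡.refl)))
                (sym (risingSum≈above ds 0 m ≡.refl)))
      wordSum≈signedSum (b ∷ ds) (tpos k) m k+m+1≡K =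
        trans (transfer-tpos b (wordSum ds) k m (≡.trans (ℕ.+-suc k m) k+m+1≡K))
        (+-cong (if-cong (not b) (*-congˡ (wordSum≈signedSum ds (tpos k) m k+m+1≡K)))
                (sym (risingSum≈above ds (suc k) m k+m+1≡K)))
      wordSum≈signedSum (b ∷ ds) (tneg k) m k+m+1≡K =
        trans (transfer-tneg b (wordSum ds) k m (≡.trans (ℕ.+-suc k m) k+m+1≡K))
        (+-cong (if-cong b (*-congˡ (wordSum≈signedSum ds (tneg k) m k+m+1≡K)))
                (+-cong (*-congˡ (wordSum≈signedSum ds (tpos k) m k+m+1≡K))
                        (sym (risingSum≈above ds (suc k) m k+m+1≡K))))

      risingSum≈above : ∀ ds s m → s ℕ.+ m ≡ K → risingSum ds (range (suc s) m) ≈ above (wordSum ds) s m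
      risingSum≈above ds s zero    _ = refl
      risingSum≈above ds s (suc m) s+m+1≡K =
        +-cong (*-congˡ (sym (+-cong (wordSum≈signedSum ds (tneg s) m s+1+m≡K) (wordSum≈signedSum ds (tpos s) m s+1+m≡K))))
               (risingSum≈above ds (suc s) m s+1+m≡K)
        where
          s+1+m≡K : suc s ℕ.+ m ≡ K
          s+1+m≡K = ≡.trans (≡.sym (ℕ.+-suc s m)) s+m+1≡K

    -- Right-hand side
    mutual
      markedSum : List Bool → Bool → Bool → ℕ → List ℕ → A
      markedSum []       e p j vs = 1#
      markedSum (b ∷ ds) e p j vs = double (peakStep p b)
        ((if allowed e p b false then z j * markedSum ds false b j vs + risingMarked ds false b vs else 0#)
         + (if allowed e p b true then risingMarked ds true b vs else 0#))

      risingMarked : List Bool → Bool → Bool → List ℕ → A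
      risingMarked ds e p []       = 0#
      risingMarked ds e p (v ∷ vs) = z v * markedSum ds e p v vs + risingMarked ds e p vs

    markedSum-after-descent : ∀ ds e e′ j vs → markedSum ds e true j vs ≡ markedSum ds e′ true j vs
    markedSum-after-descent []      e e′ j vs = ≡.refl
    markedSum-after-descent (_ ∷ _) e e′ j vs = ≡.refl

    risingMarked-after-descent : ∀ ds e e′ vs → risingMarked ds e true vs ≡ risingMarked ds e′ true vs
    risingMarked-after-descent ds e e′ []       = ≡.refl
    risingMarked-after-descent ds e e′ (v ∷ vs) =
      ≡.cong₂ (λ f g → z v * f + g) (markedSum-after-descent ds e e′ v vs) (risingMarked-after-descent ds e e′ vs)

    mutual
      signedSum⁺≈markedSum : ∀ ds j vs → signedSum ds false j vs ≈ markedSum ds false false j vs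
      signedSum⁺≈markedSum []           j vs = refl
      signedSum⁺≈markedSum (false ∷ ds) j vs =
        trans (+-cong (*-congˡ (signedSum⁺≈markedSum ds j vs)) (risingSum≈risingMarked ds false vs)) (sym (+-assoc _ _ _))
      signedSum⁺≈markedSum (true ∷ ds)  j vs = begin
        0# + risingSum ds vs                      ≈⟨ trans (+-identityˡ _) (risingSum≈risingMarked ds true vs) ⟩
        risingMarked ds false true vs + rise      ≡⟨ ≡.cong (_+ rise) (risingMarked-after-descent ds false true vs) ⟩
        rise + rise                               ≈⟨ sym (+-cong (+-identityˡ _) (+-identityˡ _)) ⟩
        (0# + rise) + (0# + rise)                 ∎
        where
          rise : A
          rise = risingMarked ds true true vs

      signedSum⁻≈markedSum : ∀ ds j vs → signedSum ds true j vs ≈ markedSum ds true false j vs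
      signedSum⁻≈markedSum []           j vs = refl
      signedSum⁻≈markedSum (false ∷ ds) j vs = trans (+-identityˡ _)
        (trans (+-cong (*-congˡ (signedSum⁺≈markedSum ds j vs)) (risingSum≈risingMarked ds false vs)) (sym (+-assoc _ _ _)))
      signedSum⁻≈markedSum (true ∷ ds)  j vs = begin
        z j * signedSum ds true j vs + (z j * signedSum ds false j vs + risingSum ds vs)
          ≈⟨ solve 4 (λ a s⁻ s⁺ u → a :* s⁻ :+ (a :* s⁺ :+ u) := a :* (s⁻ :+ s⁺) :+ u) refl (z j) _ _ _ ⟩
        z j * (signedSum ds true j vs + signedSum ds false j vs) + risingSum ds vs
          ≈⟨ +-cong (*-congˡ (signedSum±≈markedSum ds true j vs)) (risingSum≈risingMarked ds true vs) ⟩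
        z j * (stay + markedSum ds true true j vs) + (rise + risingMarked ds true true vs)
          ≡⟨ ≡.cong₂ (λ f g → z j * (stay + f) + (rise + g))
                     (markedSum-after-descent ds true false j vs) (risingMarked-after-descent ds true false vs) ⟩
        z j * (stay + stay) + (rise + rise)
          ≈⟨ solve 3 (λ a f g → a :* (f :+ f) :+ (g :+ g) := (a :* f :+ g :+ con 0) :+ (a :* f :+ g :+ con 0))
                   refl (z j) stay rise ⟩
        markedSum (true ∷ ds) true false j vs ∎
        where
          stay rise : A
          stay = markedSum ds false true j vs
          rise = risingMarked ds false true vs

      signedSum±≈markedSum : ∀ ds b j vs →
        signedSum ds true j vs + signedSum ds false j vs ≈ markedSum ds false b j vs + markedSum ds true b j vs
      signedSum±≈markedSum []           b     j vs = refl
      signedSum±≈markedSum ds@(_ ∷ _)   false j vs =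
        trans (+-comm _ _) (+-cong (signedSum⁺≈markedSum ds j vs) (signedSum⁻≈markedSum ds j vs))
      signedSum±≈markedSum (false ∷ ds) true  j vs = begin
        (0# + (z j * signedSum ds false j vs + risingSum ds vs)) + (z j * signedSum ds false j vs + risingSum ds vs)
          ≈⟨ +-cong (trans (+-identityˡ _) half≈) half≈ ⟩
        (z j * stay + (rise + rise′)) + (z j * stay + (rise + rise′))
          ≈⟨ +-cong (sym (+-assoc _ _ _)) (sym (+-assoc _ _ _)) ⟩
        markedSum (false ∷ ds) false true j vs + markedSum (false ∷ ds) true true j vs ∎
        where
          stay rise rise′ : A
          stay = markedSum ds false false j vs
          rise = risingMarked ds false false vs
          rise′ = risingMarked ds true false vs
          half≈ : z j * signedSum ds false j vs + risingSum ds vs ≈ z j * stay + (rise + rise′)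
          half≈ = +-cong (*-congˡ (signedSum⁺≈markedSum ds j vs)) (risingSum≈risingMarked ds false vs)
      signedSum±≈markedSum (true ∷ ds)  true  j vs = begin
        (z j * signedSum ds true j vs + (z j * signedSum ds false j vs + risingSum ds vs)) + (0# + risingSum ds vs)
          ≈⟨ solve 4 (λ a s⁻ s⁺ u → (a :* s⁻ :+ (a :* s⁺ :+ u)) :+ (con 0 :+ u) := a :* (s⁻ :+ s⁺) :+ (u :+ u))
                   refl (z j) _ _ _ ⟩
        z j * (signedSum ds true j vs + signedSum ds false j vs) + (risingSum ds vs + risingSum ds vs)
          ≈⟨ +-cong (*-congˡ (signedSum±≈markedSum ds true j vs))
                    (+-cong (risingSum≈risingMarked ds true vs) (risingSum≈risingMarked ds true vs)) ⟩
        z j * (stay + markedSum ds true true j vs) + ((rise + rise′) + (rise + rise′))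
          ≡⟨ ≡.cong (λ f → z j * (stay + f) + ((rise + rise′) + (rise + rise′)))
                    (markedSum-after-descent ds true false j vs) ⟩
        z j * (stay + stay) + ((rise + rise′) + (rise + rise′))
          ≈⟨ solve 4 (λ a f g g′ → a :* (f :+ f) :+ ((g :+ g′) :+ (g :+ g′))
                                := (a :* f :+ g :+ g′) :+ (a :* f :+ g :+ g′))
                   refl (z j) stay rise rise′ ⟩
        markedSum (true ∷ ds) false true j vs + markedSum (true ∷ ds) true true j vs ∎
        where
          stay rise rise′ : A
          stay = markedSum ds false true j vs
          rise = risingMarked ds false true vs
          rise′ = risingMarked ds true true vs

      risingSum≈risingMarked : ∀ ds b vs → risingSum ds vs ≈ risingMarked ds false b vs + risingMarked ds true b vs
      risingSum≈risingMarked ds b []       = sym (+-identityˡ 0#)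
      risingSum≈risingMarked ds b (v ∷ vs) = begin
        z v * (signedSum ds true v vs + signedSum ds false v vs) + risingSum ds vs
          ≈⟨ +-cong (*-congˡ (signedSum±≈markedSum ds b v vs)) (risingSum≈risingMarked ds b vs) ⟩
        z v * (markedSum ds false b v vs + markedSum ds true b v vs) + (risingMarked ds false b vs + risingMarked ds true b vs)
          ≈⟨ solve 5 (λ a f f′ g g′ → a :* (f :+ f′) :+ (g :+ g′) := (a :* f :+ g) :+ (a :* f′ :+ g′))
                   refl (z v) _ _ _ _ ⟩
        risingMarked ds false b (v ∷ vs) + risingMarked ds true b (v ∷ vs) ∎

    -- monoSum j vs U is N_U on the remaining positions, starting from value j with the values at the
    -- strict ascents U taken increasingly from vs; block is the corresponding summand of N.
    mutual
      monoSum : ℕ → List ℕ → List Bool → A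
      monoSum j vs []          = 1#
      monoSum j vs (false ∷ U) = z j * monoSum j vs U
      monoSum j vs (true ∷ U)  = risingMono vs U

      risingMono : List ℕ → List Bool → A
      risingMono []       U = 0#
      risingMono (v ∷ vs) U = z v * monoSum v vs U + risingMono vs U

    block : ℕ → ℕ → ℕ → List Bool → List ℕ → A
    block n k j U is = pow (z j) (firstOr n (elemsFrom k U) ∸ k) * monoTail n z (elemsFrom k U) is

    firstOr-elemsFrom : ∀ n k U → k ℕ.+ length U ≡ n → k ≤ firstOr n (elemsFrom k U)
    firstOr-elemsFrom n k []          k+0≡n = ≡.subst (k ≤_) k+0≡n (ℕ.m≤m+n k 0)
    firstOr-elemsFrom n k (true ∷ U)  _     = ℕ.≤-refl
    firstOr-elemsFrom n k (false ∷ U) k+l≡n =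
      ℕ.<⇒≤ (firstOr-elemsFrom n (suc k) U (≡.trans (≡.sym (ℕ.+-suc k (length U))) k+l≡n))

    pow-firstOr : ∀ x n k U → suc k ℕ.+ length U ≡ n →
      pow x (firstOr n (elemsFrom (suc k) U) ∸ k) ≈ x * pow x (firstOr n (elemsFrom (suc k) U) ∸ suc k)
    pow-firstOr x n k U k+l+1≡n = ≡⇒≈ (≡.cong (pow x) (ℕ.+-∸-assoc 1 (firstOr-elemsFrom n (suc k) U k+l+1≡n)))

    monoTail-∷ : ∀ n s ss i is → monoTail n z (s ∷ ss) (i ∷ is) ≡ pow (z i) (firstOr n ss ∸ s) * monoTail n z ss is
    monoTail-∷ n s []      i is = ≡.refl
    monoTail-∷ n s (_ ∷ _) i is = ≡.refl

    block-false : ∀ n k j U is → suc k ℕ.+ length U ≡ n →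
                  block n k j (false ∷ U) is ≈ z j * block n (suc k) j U is
    block-false n k j U is k+l+1≡n = trans (*-congʳ (pow-firstOr (z j) n k U k+l+1≡n)) (*-assoc _ _ _)

    block-true : ∀ n k j U v is → suc k ℕ.+ length U ≡ n →
                 block n k j (true ∷ U) (v ∷ is) ≈ z v * block n (suc k) v U is
    block-true n k j U v is k+l+1≡n = begin
      pow (z j) (k ∸ k) * monoTail n z (k ∷ elemsFrom (suc k) U) (v ∷ is)
        ≡⟨ ≡.cong₂ _*_ (≡.cong (pow (z j)) (ℕ.n∸n≡0 k)) (monoTail-∷ n k (elemsFrom (suc k) U) v is) ⟩
      1# * (pow (z v) (firstOr n (elemsFrom (suc k) U) ∸ k) * monoTail n z (elemsFrom (suc k) U) is)
        ≈⟨ trans (*-identityˡ _) (block-false n k v U is k+l+1≡n) ⟩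
      z v * block n (suc k) v U is ∎

    Σ-choose-∷ : ∀ (f : List ℕ → A) v vs l →
      Σ (map f (choose (v ∷ vs) (suc l))) ≈ Σ (map (f ∘ (v ∷_)) (choose vs l)) + Σ (map f (choose vs (suc l)))
    Σ-choose-∷ f v vs l = trans (Σ-map-++ f (map (v ∷_) (choose vs l)) _) (+-congʳ (Σ-map-∘ f (v ∷_) (choose vs l)))

    Σblock≈monoSum : ∀ n k j U vs → k ℕ.+ length U ≡ n →
                     Σ (map (block n k j U) (choose vs (length (elemsFrom k U)))) ≈ monoSum j vs U
    Σblock≈monoSum n k j []          vs k+0≡n = begin
      pow (z j) (n ∸ k) * 1# + 0#  ≡⟨ ≡.cong (λ t → pow (z j) t * 1# + 0#) n∸k≡0 ⟩
      1# * 1# + 0#                 ≈⟨ trans (+-identityʳ _) (*-identityˡ 1#) ⟩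
      1#                           ∎
      where
        n∸k≡0 : n ∸ k ≡ 0
        n∸k≡0 = ≡.trans (≡.cong (_∸ k) (≡.sym k+0≡n)) (ℕ.m+n∸m≡n k 0)
    Σblock≈monoSum n k j (false ∷ U) vs k+l≡n = begin
      Σ (map (block n k j (false ∷ U)) cs)             ≈⟨ Σ-map-cong cs (λ is → block-false n k j U is k+l+1≡n) ⟩
      Σ (map (λ is → z j * block n (suc k) j U is) cs) ≈⟨ Σ-map-*ˡ (z j) (block n (suc k) j U) cs ⟩
      z j * Σ (map (block n (suc k) j U) cs)           ≈⟨ *-congˡ (Σblock≈monoSum n (suc k) j U vs k+l+1≡n) ⟩
      z j * monoSum j vs U                             ∎
      where
        k+l+1≡n : suc k ℕ.+ length U ≡ n
        k+l+1≡n = ≡.trans (≡.sym (ℕ.+-suc k (length U))) k+l≡n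
        cs : List (List ℕ)
        cs = choose vs (length (elemsFrom (suc k) U))
    Σblock≈monoSum n k j (true ∷ U) vs k+l≡n = Σblock≈risingMono vs
      where
        k+l+1≡n : suc k ℕ.+ length U ≡ n
        k+l+1≡n = ≡.trans (≡.sym (ℕ.+-suc k (length U))) k+l≡n
        l : ℕ
        l = length (elemsFrom (suc k) U)
        f : List ℕ → A
        f = block n k j (true ∷ U)
        Σblock≈risingMono : ∀ vs → Σ (map f (choose vs (suc l))) ≈ risingMono vs U
        Σblock≈risingMono []       = refl
        Σblock≈risingMono (v ∷ vs) = begin
          Σ (map f (choose (v ∷ vs) (suc l)))
            ≈⟨ Σ-choose-∷ f v vs l ⟩
          Σ (map (f ∘ (v ∷_)) (choose vs l)) + Σ (map f (choose vs (suc l)))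
            ≈⟨ +-cong (trans (Σ-map-cong (choose vs l) (λ is → block-true n k j U v is k+l+1≡n))
                             (Σ-map-*ˡ (z v) _ (choose vs l)))
                      (Σblock≈risingMono vs) ⟩
          z v * Σ (map (block n (suc k) v U) (choose vs l)) + risingMono vs U
            ≈⟨ +-congʳ (*-congˡ (Σblock≈monoSum n (suc k) v U vs k+l+1≡n)) ⟩
          z v * monoSum v vs U + risingMono vs U ∎

    N≈monoSum : ∀ n U → length U ≡ n → N n K z U ≈ monoSum 0 (range 1 K) U
    N≈monoSum n U ∣U∣≡n = trans
      (≡⇒≈ (≡.cong (λ vs → Σ (map (block n 0 0 U) (choose vs (length (elems U)))))
                   (≡.trans (≡.cong (map suc) (upTo≡range K)) (map-suc-range 0 K))))
      (Σblock≈monoSum n 0 0 U (range 1 K) ∣U∣≡n)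

    separatedSum : Bool → Bool → List Bool → (List Bool → A) → A
    separatedSum e p ds g = ΣIf (separated e p ds) (subsets (length ds)) (λ D → ΣIf (subsetB D) (subsets (length ds)) g)

    module _ (e p : Bool) (ds : List Bool) where

      private
        subs : List (List Bool)
        subs = subsets (length ds)

      separatedSum-+ : ∀ g h → separatedSum e p ds (λ U → g U + h U) ≈ separatedSum e p ds g + separatedSum e p ds h
      separatedSum-+ g h =
        trans (ΣIf-congʳ (separated e p ds) subs (λ D → ΣIf-+ (subsetB D) subs g h)) (ΣIf-+ (separated e p ds) subs _ _)

      separatedSum-*ˡ : ∀ k g → separatedSum e p ds (λ U → k * g U) ≈ k * separatedSum e p ds g
      separatedSum-*ˡ k g =
        trans (ΣIf-congʳ (separated e p ds) subs (λ D → ΣIf-*ˡ (subsetB D) subs k g)) (ΣIf-*ˡ (separated e p ds) subs k _)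

      separatedSum-0 : separatedSum e p ds (λ _ → 0#) ≈ 0#
      separatedSum-0 = trans (ΣIf-congʳ (separated e p ds) subs (λ D → ΣIf-0 (subsetB D) subs)) (ΣIf-0 (separated e p ds) subs)

    separatedSum-step : ∀ e p b ds g → separatedSum e p (b ∷ ds) g ≈
      (if allowed e p b false then separatedSum false b ds (g ∘ (false ∷_)) + separatedSum false b ds (g ∘ (true ∷_)) else 0#)
      + (if allowed e p b true then separatedSum true b ds (g ∘ (true ∷_)) else 0#)
    separatedSum-step e p b ds g = begin
      ΣIf (separated e p (b ∷ ds)) (subsets (suc m)) inner
        ≈⟨ ΣIf-subsets-suc m (separated e p (b ∷ ds)) inner ⟩
      ΣIf (λ D → a₀ ∧ separated false b ds D) subs (inner ∘ (false ∷_))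
        + ΣIf (λ D → a₁ ∧ separated true b ds D) subs (inner ∘ (true ∷_))
        ≈⟨ +-cong (ΣIf-∧ a₀ (separated false b ds) subs _) (ΣIf-∧ a₁ (separated true b ds) subs _) ⟩
      (if a₀ then ΣIf (separated false b ds) subs (inner ∘ (false ∷_)) else 0#)
        + (if a₁ then ΣIf (separated true b ds) subs (inner ∘ (true ∷_)) else 0#)
        ≈⟨ +-cong (if-cong a₀ (trans (ΣIf-congʳ (separated false b ds) subs (λ D →
                                       ΣIf-subsets-suc m (subsetB (false ∷ D)) g))
                                     (ΣIf-+ (separated false b ds) subs _ _)))
                  (if-cong a₁ (ΣIf-congʳ (separated true b ds) subs (λ D →
                    trans (ΣIf-subsets-suc m (subsetB (true ∷ D)) g) (trans (+-congʳ (Σ-map-0 subs)) (+-identityˡ _))))) ⟩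
      (if a₀ then separatedSum false b ds (g ∘ (false ∷_)) + separatedSum false b ds (g ∘ (true ∷_)) else 0#)
        + (if a₁ then separatedSum true b ds (g ∘ (true ∷_)) else 0#) ∎
      where
        a₀ a₁ : Bool
        a₀ = allowed e p b false
        a₁ = allowed e p b true
        m : ℕ
        m = length ds
        subs : List (List Bool)
        subs = subsets m
        inner : List Bool → A
        inner D = ΣIf (subsetB D) (subsets (suc m)) g

    mutual
      separatedSum≈markedSum : ∀ ds e p j vs →
        two^ (peakCount p ds) * separatedSum e p ds (monoSum j vs) ≈ markedSum ds e p j vs
      separatedSum≈markedSum []       e p j vs = trans (*-identityˡ _) (trans (+-identityʳ _) (+-identityʳ 1#))
      separatedSum≈markedSum (b ∷ ds) e p j vs = begin
        two^ (peak ℕ.+ peakCount b ds) * separatedSum e p (b ∷ ds) (monoSum j vs)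
          ≈⟨ trans (*-congʳ (pow-+ (1# + 1#) peak (peakCount b ds))) (*-assoc _ _ _) ⟩
        two^ peak * (k * separatedSum e p (b ∷ ds) (monoSum j vs))
          ≈⟨ *-congˡ (trans (*-congˡ (separatedSum-step e p b ds (monoSum j vs))) (distribˡ k _ _)) ⟩
        two^ peak * (k * (if a₀ then separatedSum false b ds (λ U → z j * monoSum j vs U)
                                      + separatedSum false b ds (risingMono vs) else 0#)
                     + k * (if a₁ then separatedSum true b ds (risingMono vs) else 0#))
          ≈⟨ *-congˡ (+-cong (trans (sym (if-*ˡ a₀ k _)) (if-cong a₀ stay-or-rise))
                             (trans (sym (if-*ˡ a₁ k _)) (if-cong a₁ (separatedSum≈risingMarked ds true b vs)))) ⟩
        two^ peak * ((if a₀ then z j * markedSum ds false b j vs + risingMarked ds false b vs else 0#)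
                     + (if a₁ then risingMarked ds true b vs else 0#))
          ≈⟨ two^-indicator (peakStep p b) _ ⟩
        markedSum (b ∷ ds) e p j vs ∎
        where
          peak : ℕ
          peak = if peakStep p b then 1 else 0
          a₀ a₁ : Bool
          a₀ = allowed e p b false
          a₁ = allowed e p b true
          k : A
          k = two^ (peakCount b ds)
          stay-or-rise : k * (separatedSum false b ds (λ U → z j * monoSum j vs U) + separatedSum false b ds (risingMono vs))
                         ≈ z j * markedSum ds false b j vs + risingMarked ds false b vs
          stay-or-rise = begin
            k * (separatedSum false b ds (λ U → z j * monoSum j vs U) + separatedSum false b ds (risingMono vs))
              ≈⟨ *-congˡ (+-congʳ (separatedSum-*ˡ false b ds (z j) (monoSum j vs))) ⟩
            k * (z j * separatedSum false b ds (monoSum j vs) + separatedSum false b ds (risingMono vs))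
              ≈⟨ solve 4 (λ k a f g → k :* (a :* f :+ g) := a :* (k :* f) :+ k :* g) refl k (z j) _ _ ⟩
            z j * (k * separatedSum false b ds (monoSum j vs)) + k * separatedSum false b ds (risingMono vs)
              ≈⟨ +-cong (*-congˡ (separatedSum≈markedSum ds false b j vs)) (separatedSum≈risingMarked ds false b vs) ⟩
            z j * markedSum ds false b j vs + risingMarked ds false b vs ∎

      separatedSum≈risingMarked : ∀ ds e p vs →
        two^ (peakCount p ds) * separatedSum e p ds (risingMono vs) ≈ risingMarked ds e p vs
      separatedSum≈risingMarked ds e p []       = trans (*-congˡ (separatedSum-0 e p ds)) (zeroʳ _)
      separatedSum≈risingMarked ds e p (v ∷ vs) = begin
        k * separatedSum e p ds (λ U → z v * monoSum v vs U + risingMono vs U)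
          ≈⟨ *-congˡ (trans (separatedSum-+ e p ds _ (risingMono vs))
                            (+-congʳ (separatedSum-*ˡ e p ds (z v) (monoSum v vs)))) ⟩
        k * (z v * separatedSum e p ds (monoSum v vs) + separatedSum e p ds (risingMono vs))
          ≈⟨ solve 4 (λ k a f g → k :* (a :* f :+ g) := a :* (k :* f) :+ k :* g) refl k (z v) _ _ ⟩
        z v * (k * separatedSum e p ds (monoSum v vs)) + k * separatedSum e p ds (risingMono vs)
          ≈⟨ +-cong (*-congˡ (separatedSum≈markedSum ds e p v vs)) (separatedSum≈risingMarked ds e p vs) ⟩
        z v * markedSum ds e p v vs + risingMarked ds e p vs ∎
        where
          k : A
          k = two^ (peakCount p ds)

    RHS≈markedSum : ∀ {n} (π : SignedPerm n) → 1 ≤ n →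
                    RHS π K z ≈ markedSum (descentWord π 0 n) false false 0 (range 1 K)
    RHS≈markedSum {n} π 1≤n = begin
      two^ (peB π ℕ.+ ς π) * ΣIf (condD π) (subsets n) (λ D → ΣIf (subsetB D) (subsets n) (N n K z))
        ≈⟨ *-cong (≡⇒≈ (≡.cong two^ (peB+ς≡peakCount π 1≤n)))
                  (ΣIf-cong (subsets n) (condD≡separated π 1≤n) (λ D → ΣIf-subsets-cong n (subsetB D) (N≈monoSum n))) ⟩
      two^ (peakCount false ds) * ΣIf (separated false false ds) (subsets n) (λ D → ΣIf (subsetB D) (subsets n) g)
        ≡⟨ ≡.cong (λ m → two^ (peakCount false ds) * ΣIf (separated false false ds) (subsets m)
                                                           (λ D → ΣIf (subsetB D) (subsets m) g))
                  (≡.sym (length-descentWord π 0 n)) ⟩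
      two^ (peakCount false ds) * separatedSum false false ds g
        ≈⟨ separatedSum≈markedSum ds false false 0 (range 1 K) ⟩
      markedSum ds false false 0 (range 1 K) ∎
      where
        ds : List Bool
        ds = descentWord π 0 n
        g : List Bool → A
        g = monoSum 0 (range 1 K)

theorem6p6 : ∀ {c ℓ} (R : CommutativeSemiring c ℓ) (n : ℕ) → 1 ≤ n →
             (π : SignedPerm n) (K : ℕ) (z : ℕ → CommutativeSemiring.Carrier R) →
             CommutativeSemiring._≈_ R (Eval.DB R π K z) (Eval.RHS R π K z)
theorem6p6 R n 1≤n π K z = begin
  DB π K z                                ≈⟨ validSum≈wordSum π 0 n t0 ⟩
  wordSum ds t0                           ≈⟨ wordSum≈signedSum ds t0 K ≡.refl ⟩
  signedSum ds false 0 (range 1 K)        ≈⟨ signedSum⁺≈markedSum ds 0 (range 1 K) ⟩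
  markedSum ds false false 0 (range 1 K)  ≈⟨ RHS≈markedSum π 1≤n ⟨
  RHS π K z                               ∎
  where
    open CommutativeSemiring R using (setoid)
    open Eval R using (DB; RHS)
    open WithSemiring R
    open Truncated K z
    open import Relation.Binary.Reasoning.Setoid setoid
    ds : List Bool
    ds = descentWord π 0 n
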